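{- Let $t$ be a checkers term. (1) Soundness: if $\Gamma\vdash^kt:L$ is derivable, then there exists $k'\le k$ such that $t\Downarrow^{k'}$. (2) Completeness: if $t\Downarrow^k$, then $\Gamma\vdash^kt:L$ is derivable for some environment $\Gamma$ and linear type $L$.
   Context: Checkers terms: $t,u ::= x\mid\lambda_cx.t\mid t\cdot^cu$, $c\in\{\circ,\bullet\}$, modulo $\alpha$. A redex $(\lambda_cx.t)\cdot^du$ contracts to $t\{x:=u\}$; silent if $c=d$, interaction if $c\ne d$. Head contexts $H ::= \lambda_{c_1}x_1\ldots\lambda_{c_n}x_n.(\cdots(\langle\cdot\rangle\cdot^{d_1}t_1)\cdots)\cdot^{d_k}t_k$; checkers head reduction contracts redexes at $H\langle r\rangle$ (deterministic). $t\Downarrow^k$: the head reduction of $t$ reaches a term without head redex, with exactly $k$ interaction head steps. Types: linear $L ::= X\mid M\to_cL$ ($X$ atoms); multi $M ::= [L_1,\ldots,L_n]$ (finite multisets); environments $\Gamma$ map variables to multi types with finite support, $+$ pointwise union, $\Gamma,x:M$ with $x\notin\mathrm{supp}(\Gamma)$. Rules: (ax) $x:[L]\vdash^0x:L$; (many) from $\Gamma_i\vdash^{k_i}t:L_i$ ($i\in I$ finite) infer $\sum\Gamma_i\vdash^{\sum k_i}t:[L_i]_{i\in I}$; ($\lambda$) from $\Gamma,x:M\vdash^kt:L$ infer $\Gamma\vdash^k\lambda_cx.t:M\to_cL$; (@) from $\Gamma\vdash^{k_1}t:M\to_cL$ and $\Delta\vdash^{k_2}u:M$ infer $\Gamma+\Delta\vdash^kt\cdot^du:L$,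 $k=k_1+k_2$ if $c=d$, else $k_1+k_2+1$. -}

module Defs where

open import Data.Nat using (ℕ; zero; suc; _+_)
open import Data.Fin using (Fin; zero; suc)
open import Data.Bool using (Bool; true; false)
open import Data.List using (List; []; _∷_; _++_)
open import Data.List.Relation.Binary.Permutation.Propositional using (_↭_)
open import Data.Vec using (Vec; []; _∷_; zipWith; replicate; _[_]≔_)
open import Data.Empty using (⊥)
open import Relation.Nullary using (¬_)

-- Colours and checkers terms (de Bruijn indices, so α-equivalence is
-- syntactic equality). Term n = terms with free variables among Fin n.

data Col : Set where
  ∘ ● : Col

interaction? : Col → Col → Bool
interaction? ∘ ∘ = false
interaction? ● ● = false
interaction? ∘ ● = true
interaction? ● ∘ = true

data Term (n : ℕ) : Set where
  var : Fin n → Term n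
  lam : Col → Term (suc n) → Term n
  app : Term n → Col → Term n → Term n

Ren : ℕ → ℕ → Set
Ren m n = Fin m → Fin n

ext : ∀ {m n} → Ren m n → Ren (suc m) (suc n)
ext ρ zero = zero
ext ρ (suc i) = suc (ρ i)

rename : ∀ {m n} → Ren m n → Term m → Term n
rename ρ (var i) = var (ρ i)
rename ρ (lam c t) = lam c (rename (ext ρ) t)
rename ρ (app t d u) = app (rename ρ t) d (rename ρ u)

Sub : ℕ → ℕ → Set
Sub m n = Fin m → Term n

exts : ∀ {m n} → Sub m n → Sub (suc m) (suc n)
exts σ zero = var zero
exts σ (suc i) = rename suc (σ i)

subst : ∀ {m n} → Sub m n → Term m → Term n
subst σ (var i) = σ i
subst σ (lam c t) = lam c (subst (exts σ) t)
subst σ (app t d u) = app (subst σ t) d (subst σ u)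

single : ∀ {n} → Term n → Sub (suc n) n
single u zero = u
single u (suc i) = var i

_[_] : ∀ {n} → Term (suc n) → Term n → Term n
t [ u ] = subst (single u) t

-- A head context is
--   λ_{c1}x1 … λ_{cn}xn . ( … (⟨·⟩ ·^{d1} t1) … ) ·^{dk} tk
-- We split it into the λ-prefix (_⟶h[_]_) and the application spine
-- (_⟶s[_]_).  The Bool records whether the step is an interaction step.

data _⟶s[_]_ {n : ℕ} : Term n → Bool → Term n → Set where
  β : ∀ {c d t u} → app (lam c t) d u ⟶s[ interaction? c d ] (t [ u ])
  appS : ∀ {t t' d u b} → t ⟶s[ b ] t' → app t d u ⟶s[ b ] app t' d u

data _⟶h[_]_ : {n : ℕ} → Term n → Bool → Term n → Set where
  spine : ∀ {n} {t t' : Term n} {b} → t ⟶s[ b ] t' → t ⟶h[ b ] t'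
  lamH : ∀ {n c} {t t' : Term (suc n)} {b} → t ⟶h[ b ] t' → lam c t ⟶h[ b ] lam c t'

NoHeadRedex : ∀ {n} → Term n → Set
NoHeadRedex t = ∀ b t' → ¬ (t ⟶h[ b ] t')

count : Bool → ℕ → ℕ
count true k = suc k
count false k = k

data _⇓_ {n : ℕ} : Term n → ℕ → Set where
  stop : ∀ {t} → NoHeadRedex t → t ⇓ 0
  step : ∀ {t t' b k} → t ⟶h[ b ] t' → t' ⇓ k → t ⇓ count b k

-- Types.  Atoms are natural numbers.  Multi types (finite multisets) are
-- represented by lists, considered up to (deep) permutation: _≈L_/_≈M_.

data LType : Set where
  atom : ℕ → LType
  _⇒[_]_ : List LType → Col → LType → LType

MType : Set
MType = List LType

mutual
  data _≈L_ : LType → LType → Set where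
    atom≈ : ∀ {X} → atom X ≈L atom X
    arr≈  : ∀ {M M' c L L'} → M ≈M M' → L ≈L L' → (M ⇒[ c ] L) ≈L (M' ⇒[ c ] L')

  data _≈M_ : MType → MType → Set where
    perm≈ : ∀ {M M'' M'} → M ↭ M'' → M'' ≈Pw M' → M ≈M M'

  data _≈Pw_ : MType → MType → Set where
    []≈  : [] ≈Pw []
    _∷≈_ : ∀ {L L' M M'} → L ≈L L' → M ≈Pw M' → (L ∷ M) ≈Pw (L' ∷ M')

-- Environments for Term n: a multi type for each of the n variables
-- (finite support automatically).  Sum is pointwise multiset union.
Env : ℕ → Set
Env n = Vec MType n

∅ : ∀ {n} → Env n
∅ = replicate _ []

_⊕_ : ∀ {n} → Env n → Env n → Env n
_⊕_ = zipWith _++_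

_∶ₑ_ : ∀ {n} → Fin n → MType → Env n
x ∶ₑ M = ∅ [ x ]≔ M

cost : Col → Col → ℕ → ℕ → ℕ
cost c d k₁ k₂ = count (interaction? c d) (k₁ + k₂)

mutual
  data _⊢[_]_∶_ : {n : ℕ} → Env n → ℕ → Term n → LType → Set where
    ax  : ∀ {n} {x : Fin n} {L} → (x ∶ₑ (L ∷ [])) ⊢[ 0 ] var x ∶ L
    lamT : ∀ {n} {Γ : Env n} {M k t L c} →
           (M ∷ Γ) ⊢[ k ] t ∶ L → Γ ⊢[ k ] lam c t ∶ (M ⇒[ c ] L)
    appT : ∀ {n} {Γ Δ : Env n} {k₁ k₂ t u c d M M' L} →
           Γ ⊢[ k₁ ] t ∶ (M ⇒[ c ] L) → Δ ⊢M[ k₂ ] u ∶ M' → M ≈M M' →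
           (Γ ⊕ Δ) ⊢[ cost c d k₁ k₂ ] app t d u ∶ L

  -- (many), with the finite index set presented as a list
  data _⊢M[_]_∶_ : {n : ℕ} → Env n → ℕ → Term n → MType → Set where
    many[] : ∀ {n} {t : Term n} → ∅ ⊢M[ 0 ] t ∶ []
    many∷  : ∀ {n} {Γ Δ : Env n} {k j t L M} →
             Γ ⊢[ k ] t ∶ L → Δ ⊢M[ j ] t ∶ M → (Γ ⊕ Δ) ⊢M[ k + j ] t ∶ (L ∷ M)

{-# OPTIONS --safe #-}
-- Soundness is a termination argument on derivations indexed by their size.  A head step
-- t ⟶ t′ turns a derivation of t into a strictly smaller one of t′ whose counter is one
-- less exactly at an interaction step: the λ and @ rules of the contracted redex vanish,
-- and each axiom for the bound variable is replaced by one of the derivations that (many)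
-- provided for the argument.  The counter is only an upper bound because a derivation may
-- also type redexes inside arguments, which head reduction never fires.  Multi types are
-- compared up to permutation, so the sized system uses the equivalence closure ∼ of ≈,
-- which is closed under the compositions that subject reduction produces.
--
-- Completeness runs the other way: a head normal form λ…λ. x t₁ … tₘ is typable with
-- counter 0 by giving every tᵢ the empty multi type, and head expansion preserves
-- typability, adding one to the counter exactly at interaction steps.
module Submission where

open import Defs
open import Data.Nat using (ℕ; zero; suc; _+_; _≤_; _<_; z≤n; s≤s)
open import Data.Nat.Properties
  using (≤-refl; ≤-trans; ≤-reflexive; n≤1+n; +-mono-≤; +-monoˡ-<; +-identityʳ; +-assoc; +-commutativeSemigroup)
open import Data.Nat.Induction using (<-rec)
open import Algebra.Properties.CommutativeSemigroup +-commutativeSemigroup using (interchange; x∙yz≈y∙xz)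
open import Data.Bool using (true; false)
open import Data.Empty using (⊥-elim)
open import Data.Fin using (Fin; zero; suc; _↑ʳ_)
open import Data.List using ([]; _∷_; _++_)
open import Data.List.Relation.Binary.Permutation.Propositional using (_↭_; refl; prep; swap; trans; ↭-sym)
open import Data.Product using (_×_; ∃-syntax; _,_; proj₂; map)
open import Data.Sum using (_⊎_; inj₁; inj₂)
open import Data.Vec using (_∷_; lookup)
open import Data.Vec.Properties using (lookup-zipWith; lookup-replicate)
open import Function.Bundles using (_⇔_; mk⇔; Equivalence)
open import Function.Properties.Equivalence using () renaming (refl to ⇔-refl; sym to ⇔-sym; trans to ⇔-trans)
open import Relation.Binary.PropositionalEquality as ≡ using (_≡_; refl; sym; cong)

count-+ : ∀ b x y → count b x + y ≡ count b (x + y)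
count-+ true  x y = refl
count-+ false x y = refl

count-comm : ∀ b b′ x → count b (count b′ x) ≡ count b′ (count b x)
count-comm true  true  x = refl
count-comm true  false x = refl
count-comm false true  x = refl
count-comm false false x = refl

count-mono-≤ : ∀ b {x y} → x ≤ y → count b x ≤ count b y
count-mono-≤ true  x≤y = s≤s x≤y
count-mono-≤ false x≤y = x≤y

cost-countˡ : ∀ c d b k₁ k₂ → cost c d (count b k₁) k₂ ≡ count b (cost c d k₁ k₂)
cost-countˡ c d b k₁ k₂ =
  ≡.trans (cong (count (interaction? c d)) (count-+ b k₁ k₂))
          (count-comm (interaction? c d) b (k₁ + k₂))

cost-+ : ∀ c d k₁ a k₂ b → cost c d (k₁ + a) (k₂ + b) ≡ cost c d k₁ k₂ + (a + b)
cost-+ c d k₁ a k₂ b =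
  ≡.trans (cong (count (interaction? c d)) (interchange k₁ a k₂ b))
          (sym (count-+ (interaction? c d) (k₁ + k₂) (a + b)))

cost-same : ∀ d → cost d d 0 0 ≡ 0
cost-same ∘ = refl
cost-same ● = refl

+-mono-≤-interchange : ∀ {a d} b c e f → a ≤ b + c → d ≤ e + f → a + d ≤ (b + e) + (c + f)
+-mono-≤-interchange b c e f a≤ d≤ = ≤-trans (+-mono-≤ a≤ d≤) (≤-reflexive (interchange b c e f))

-- Closing only at the level of multisets keeps ∼L structural, so arrow types
-- decompose by pattern matching.

infix 4 _∼L_ _∼M_
infixr 5 _∷∼_

mutual
  data _∼L_ : LType → LType → Set where
    atom∼ : ∀ {X} → atom X ∼L atom X
    _⇒∼_  : ∀ {M M′ c L L′} → M ∼M M′ → L ∼L L′ → (M ⇒[ c ] L) ∼L (M′ ⇒[ c ] L′)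

  data _∼M_ : MType → MType → Set where
    ∼M-refl  : ∀ {M} → M ∼M M
    ∼M-sym   : ∀ {M M′} → M ∼M M′ → M′ ∼M M
    ∼M-trans : ∀ {M M′ M″} → M ∼M M′ → M′ ∼M M″ → M ∼M M″
    ∼M-perm  : ∀ {M M′} → M ↭ M′ → M ∼M M′
    _∷∼_     : ∀ {L L′ M M′} → L ∼L L′ → M ∼M M′ → (L ∷ M) ∼M (L′ ∷ M′)

∼L-refl : ∀ {L} → L ∼L L
∼L-refl {atom X}      = atom∼
∼L-refl {M ⇒[ c ] L} = ∼M-refl ⇒∼ ∼L-refl

∼L-sym : ∀ {L L′} → L ∼L L′ → L′ ∼L L
∼L-sym atom∼    = atom∼
∼L-sym (m ⇒∼ l) = ∼M-sym m ⇒∼ ∼L-sym l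

∼L-trans : ∀ {L L′ L″} → L ∼L L′ → L′ ∼L L″ → L ∼L L″
∼L-trans atom∼    atom∼      = atom∼
∼L-trans (m ⇒∼ l) (m′ ⇒∼ l′) = ∼M-trans m m′ ⇒∼ ∼L-trans l l′

mutual
  ≈L⇒∼L : ∀ {L L′} → L ≈L L′ → L ∼L L′
  ≈L⇒∼L atom≈       = atom∼
  ≈L⇒∼L (arr≈ m l) = ≈M⇒∼M m ⇒∼ ≈L⇒∼L l

  ≈M⇒∼M : ∀ {M M′} → M ≈M M′ → M ∼M M′
  ≈M⇒∼M (perm≈ p w) = ∼M-trans (∼M-perm p) (≈Pw⇒∼M w)

  ≈Pw⇒∼M : ∀ {M M′} → M ≈Pw M′ → M ∼M M′
  ≈Pw⇒∼M []≈       = ∼M-refl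
  ≈Pw⇒∼M (l ∷≈ w) = ≈L⇒∼L l ∷∼ ≈Pw⇒∼M w

mutual
  ≈L-refl : ∀ L → L ≈L L
  ≈L-refl (atom X)      = atom≈
  ≈L-refl (M ⇒[ c ] L) = arr≈ (≈M-refl M) (≈L-refl L)

  ≈M-refl : ∀ M → M ≈M M
  ≈M-refl M = perm≈ refl (≈Pw-refl M)

  ≈Pw-refl : ∀ M → M ≈Pw M
  ≈Pw-refl []      = []≈
  ≈Pw-refl (L ∷ M) = ≈L-refl L ∷≈ ≈Pw-refl M

mutual
  data _⊢ˢ[_,_]_∶_ : {n : ℕ} → Env n → ℕ → ℕ → Term n → LType → Set where
    axˢ  : ∀ {n} {x : Fin n} {L} → (x ∶ₑ (L ∷ [])) ⊢ˢ[ 0 , 1 ] var x ∶ L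
    lamˢ : ∀ {n} {Γ : Env n} {M k s t L c} →
           (M ∷ Γ) ⊢ˢ[ k , s ] t ∶ L → Γ ⊢ˢ[ k , suc s ] lam c t ∶ (M ⇒[ c ] L)
    appˢ : ∀ {n} {Γ Δ : Env n} {k₁ k₂ s₁ s₂ t u c d M M′ L} →
           Γ ⊢ˢ[ k₁ , s₁ ] t ∶ (M ⇒[ c ] L) → Δ ⊢ˢᴹ[ k₂ , s₂ ] u ∶ M′ → M ∼M M′ →
           (Γ ⊕ Δ) ⊢ˢ[ cost c d k₁ k₂ , suc (s₁ + s₂) ] app t d u ∶ L

  data _⊢ˢᴹ[_,_]_∶_ : {n : ℕ} → Env n → ℕ → ℕ → Term n → MType → Set where
    manyˢ[] : ∀ {n} {t : Term n} → ∅ ⊢ˢᴹ[ 0 , 0 ] t ∶ []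
    manyˢ∷  : ∀ {n} {Γ Δ : Env n} {k j s r t L M} →
              Γ ⊢ˢ[ k , s ] t ∶ L → Δ ⊢ˢᴹ[ j , r ] t ∶ M → (Γ ⊕ Δ) ⊢ˢᴹ[ k + j , s + r ] t ∶ (L ∷ M)

mutual
  sized : ∀ {n} {Γ : Env n} {k t L} → Γ ⊢[ k ] t ∶ L → ∃[ s ] Γ ⊢ˢ[ k , s ] t ∶ L
  sized ax       = 1 , axˢ
  sized (lamT D) = map suc lamˢ (sized D)
  sized (appT D Du e) with sized D | sizedᴹ Du
  ... | _ , Dˢ | _ , Duˢ = _ , appˢ Dˢ Duˢ (≈M⇒∼M e)

  sizedᴹ : ∀ {n} {Γ : Env n} {k t M} → Γ ⊢M[ k ] t ∶ M → ∃[ s ] Γ ⊢ˢᴹ[ k , s ] t ∶ M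
  sizedᴹ many[] = 0 , manyˢ[]
  sizedᴹ (many∷ D Dm) with sized D | sizedᴹ Dm
  ... | _ , Dˢ | _ , Dmˢ = _ , manyˢ∷ Dˢ Dmˢ

cast : ∀ {n} {Γ : Env n} {k k′ t L} → k ≡ k′ → Γ ⊢[ k ] t ∶ L → Γ ⊢[ k′ ] t ∶ L
cast refl D = D

castᴹ : ∀ {n} {Γ : Env n} {k k′ t M} → k ≡ k′ → Γ ⊢M[ k ] t ∶ M → Γ ⊢M[ k′ ] t ∶ M
castᴹ refl D = D

castˢ : ∀ {n} {Γ : Env n} {k k′ s t L} → k ≡ k′ → Γ ⊢ˢ[ k , s ] t ∶ L → Γ ⊢ˢ[ k′ , s ] t ∶ L
castˢ refl D = D

castˢᴹ : ∀ {n} {Γ : Env n} {k k′ s t M} → k ≡ k′ → Γ ⊢ˢᴹ[ k , s ] t ∶ M → Γ ⊢ˢᴹ[ k′ , s ] t ∶ M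
castˢᴹ refl D = D

weakenAt : ∀ p {n} → Ren (p + n) (p + suc n)
weakenAt zero    = suc
weakenAt (suc p) = ext (weakenAt p)

weakenEnv : ∀ p {n} → Env (p + n) → Env (p + suc n)
weakenEnv zero    Γ       = [] ∷ Γ
weakenEnv (suc p) (A ∷ Γ) = A ∷ weakenEnv p Γ

weakenEnv-∅ : ∀ p {n} → weakenEnv p {n} ∅ ≡ ∅
weakenEnv-∅ zero    = refl
weakenEnv-∅ (suc p) = cong ([] ∷_) (weakenEnv-∅ p)

weakenEnv-⊕ : ∀ p {n} (Γ Δ : Env (p + n)) → weakenEnv p (Γ ⊕ Δ) ≡ weakenEnv p Γ ⊕ weakenEnv p Δ
weakenEnv-⊕ zero    Γ       Δ       = refl
weakenEnv-⊕ (suc p) (A ∷ Γ) (B ∷ Δ) = cong ((A ++ B) ∷_) (weakenEnv-⊕ p Γ Δ)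

weakenEnv-∶ₑ : ∀ p {n} (x : Fin (p + n)) M → weakenEnv p (x ∶ₑ M) ≡ weakenAt p x ∶ₑ M
weakenEnv-∶ₑ zero    x       M = refl
weakenEnv-∶ₑ (suc p) zero    M = cong (M ∷_) (weakenEnv-∅ p)
weakenEnv-∶ₑ (suc p) (suc x) M = cong ([] ∷_) (weakenEnv-∶ₑ p x M)

mutual
  weakenˢ : ∀ p {n} {Γ : Env (p + n)} {k s t L} →
            Γ ⊢ˢ[ k , s ] t ∶ L → weakenEnv p Γ ⊢ˢ[ k , s ] rename (weakenAt p) t ∶ L
  weakenˢ p (axˢ {x = x} {L}) =
    ≡.subst (_⊢ˢ[ 0 , 1 ] var (weakenAt p x) ∶ L) (sym (weakenEnv-∶ₑ p x (L ∷ []))) axˢ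
  weakenˢ p (lamˢ D) = lamˢ (weakenˢ (suc p) D)
  weakenˢ p (appˢ {Γ = Γ} {Δ} D Du e) =
    ≡.subst (λ Γ′ → Γ′ ⊢ˢ[ _ , _ ] _ ∶ _) (sym (weakenEnv-⊕ p Γ Δ)) (appˢ (weakenˢ p D) (weakenˢᴹ p Du) e)

  weakenˢᴹ : ∀ p {n} {Γ : Env (p + n)} {k s t M} →
             Γ ⊢ˢᴹ[ k , s ] t ∶ M → weakenEnv p Γ ⊢ˢᴹ[ k , s ] rename (weakenAt p) t ∶ M
  weakenˢᴹ p {t = t} manyˢ[] =
    ≡.subst (_⊢ˢᴹ[ 0 , 0 ] rename (weakenAt p) t ∶ []) (sym (weakenEnv-∅ p)) manyˢ[]
  weakenˢᴹ p (manyˢ∷ {Γ = Γ} {Δ} D Dm) =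
    ≡.subst (λ Γ′ → Γ′ ⊢ˢᴹ[ _ , _ ] _ ∶ _) (sym (weakenEnv-⊕ p Γ Δ)) (manyˢ∷ (weakenˢ p D) (weakenˢᴹ p Dm))

mutual
  weaken⁻ : ∀ p {n} (t : Term (p + n)) {Γ : Env (p + suc n)} {k L} →
            Γ ⊢[ k ] rename (weakenAt p) t ∶ L → ∃[ Γ′ ] (Γ ≡ weakenEnv p Γ′ × Γ′ ⊢[ k ] t ∶ L)
  weaken⁻ p (var x) (ax {L = L}) = _ , sym (weakenEnv-∶ₑ p x (L ∷ [])) , ax
  weaken⁻ p (lam c t) (lamT D) with weaken⁻ (suc p) t D
  ... | M ∷ Γ′ , refl , D′ = Γ′ , refl , lamT D′
  weaken⁻ p (app t d u) (appT D Du e) with weaken⁻ p t D | weaken⁻ᴹ p u Du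
  ... | Γ₁ , refl , D₁ | Γ₂ , refl , D₂ = Γ₁ ⊕ Γ₂ , sym (weakenEnv-⊕ p Γ₁ Γ₂) , appT D₁ D₂ e

  weaken⁻ᴹ : ∀ p {n} (t : Term (p + n)) {Γ : Env (p + suc n)} {k M} →
             Γ ⊢M[ k ] rename (weakenAt p) t ∶ M → ∃[ Γ′ ] (Γ ≡ weakenEnv p Γ′ × Γ′ ⊢M[ k ] t ∶ M)
  weaken⁻ᴹ p t many[] = ∅ , sym (weakenEnv-∅ p) , many[]
  weaken⁻ᴹ p t (many∷ D Dm) with weaken⁻ p t D | weaken⁻ᴹ p t Dm
  ... | Γ₁ , refl , D₁ | Γ₂ , refl , D₂ = Γ₁ ⊕ Γ₂ , sym (weakenEnv-⊕ p Γ₁ Γ₂) , many∷ D₁ D₂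

-- Substitution for the variable j ↑ʳ zero, the one bound just outside j binders.

substAt : ∀ j {n} → Term n → Sub (j + suc n) (j + n)
substAt zero    u = single u
substAt (suc j) u = exts (substAt j u)

lookup-∅ : ∀ {n} (i : Fin n) → lookup ∅ i ≡ []
lookup-∅ i = lookup-replicate i []

lookup-⊕ : ∀ {n} (i : Fin n) (Γ Δ : Env n) → lookup (Γ ⊕ Δ) i ≡ lookup Γ i ++ lookup Δ i
lookup-⊕ i = lookup-zipWith _++_ i

data Agree : (j : ℕ) {a b : ℕ} → Env (j + a) → Env (j + b) → Set where
  start : ∀ {a b} {Γ : Env a} {Γ′ : Env b} → Agree zero Γ Γ′
  keep  : ∀ {j a b A} {Γ : Env (j + a)} {Γ′ : Env (j + b)} → Agree j Γ Γ′ → Agree (suc j) (A ∷ Γ) (A ∷ Γ′)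

Agree-∅ : ∀ j {a b} → Agree j {a} {b} ∅ ∅
Agree-∅ zero    = start
Agree-∅ (suc j) = keep (Agree-∅ j)

Agree-⊕ : ∀ {j a b} {Γ₁ Γ₂ : Env (j + a)} {Δ₁ Δ₂ : Env (j + b)} →
          Agree j Γ₁ Δ₁ → Agree j Γ₂ Δ₂ → Agree j (Γ₁ ⊕ Γ₂) (Δ₁ ⊕ Δ₂)
Agree-⊕ start    start    = start
Agree-⊕ (keep p) (keep q) = keep (Agree-⊕ p q)

-- What may replace a variable of multi type M: one sized derivation of u per element
-- of M, each up to ∼L and with its own environment (which substitution discards).

data Args {n} (u : Term n) : MType → ℕ → ℕ → Set where
  nil  : Args u [] 0 0
  cons : ∀ {Δ k₁ s₁ L L′ M k s} →
         Δ ⊢ˢ[ k₁ , s₁ ] u ∶ L′ → L ∼L L′ → Args u M k s → Args u (L ∷ M) (k₁ + k) (s₁ + s)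

Args-fromᴹ : ∀ {n} {Δ : Env n} {u k s M} → Δ ⊢ˢᴹ[ k , s ] u ∶ M → Args u M k s
Args-fromᴹ manyˢ[]      = nil
Args-fromᴹ (manyˢ∷ D Dm) = cons D ∼L-refl (Args-fromᴹ Dm)

Args-empty : ∀ {n} {u : Term n} {M k s} → M ≡ [] → Args u M k s → k ≡ 0 × s ≡ 0
Args-empty refl nil = refl , refl

Args-single : ∀ {n} {u : Term n} {L k s} → Args u (L ∷ []) k s →
              ∃[ Δ ] ∃[ L′ ] (L ∼L L′ × Δ ⊢ˢ[ k , s ] u ∶ L′)
Args-single {u = u} (cons {k₁ = k₁} {s₁} D e nil) =
  _ , _ , e , ≡.subst₂ (λ k s → _ ⊢ˢ[ k , s ] u ∶ _) (sym (+-identityʳ k₁)) (sym (+-identityʳ s₁)) D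

Args-↭ : ∀ {n} {u : Term n} {M M′ k s} → M ↭ M′ → Args u M k s → Args u M′ k s
Args-↭ refl         a = a
Args-↭ (prep _ p)   (cons D e a) = cons D e (Args-↭ p a)
Args-↭ (swap _ _ p) (cons {k₁ = k₁} {s₁} D₁ e₁ (cons {k₁ = k₂} {s₂} {k = k} {s} D₂ e₂ a)) =
  ≡.subst₂ (Args _ _) (x∙yz≈y∙xz k₂ k₁ k) (x∙yz≈y∙xz s₂ s₁ s) (cons D₂ e₂ (cons D₁ e₁ (Args-↭ p a)))
Args-↭ (trans p q)  a = Args-↭ q (Args-↭ p a)

Args-∼ : ∀ {n} {u : Term n} {M M′ k s} → M ∼M M′ → Args u M k s ⇔ Args u M′ k s
Args-∼ ∼M-refl          = ⇔-refl
Args-∼ (∼M-sym e)       = ⇔-sym (Args-∼ e)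
Args-∼ (∼M-trans e e′)  = ⇔-trans (Args-∼ e) (Args-∼ e′)
Args-∼ (∼M-perm p)      = mk⇔ (Args-↭ p) (Args-↭ (↭-sym p))
Args-∼ (eL ∷∼ eM)       = mk⇔
  (λ { (cons D e a) → cons D (∼L-trans (∼L-sym eL) e) (Equivalence.to (Args-∼ eM) a) })
  (λ { (cons D e a) → cons D (∼L-trans eL e) (Equivalence.from (Args-∼ eM) a) })

Args-++⁻ : ∀ {n} {u : Term n} A {B k s} → Args u (A ++ B) k s →
  ∃[ ka ] ∃[ sa ] ∃[ kb ] ∃[ sb ] (Args u A ka sa × Args u B kb sb × k ≡ ka + kb × s ≡ sa + sb)
Args-++⁻ []      a = 0 , 0 , _ , _ , nil , a , refl , refl
Args-++⁻ (L ∷ A) (cons {k₁ = k₁} {s₁} D e a) with Args-++⁻ A a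
... | ka , sa , kb , sb , a₁ , a₂ , refl , refl =
  k₁ + ka , s₁ + sa , kb , sb , cons D e a₁ , a₂ , sym (+-assoc k₁ ka kb) , sym (+-assoc s₁ sa sb)

subst-typingˢ-var : ∀ j {n} (i : Fin (j + suc n)) (u : Term n) {L k₂ s₂} →
  Args u (lookup (i ∶ₑ (L ∷ [])) (j ↑ʳ zero)) k₂ s₂ →
  ∃[ Γ′ ] ∃[ L′ ] ∃[ s′ ]
    (Agree j (i ∶ₑ (L ∷ [])) Γ′ × L ∼L L′ × s′ ≤ 1 + s₂ × Γ′ ⊢ˢ[ k₂ , s′ ] substAt j u i ∶ L′)
subst-typingˢ-var zero    zero    u {s₂ = s₂} a with Args-single a
... | Δ , L′ , e , D = Δ , L′ , s₂ , start , e , n≤1+n s₂ , D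
subst-typingˢ-var zero    (suc i) u nil = _ , _ , 1 , start , ∼L-refl , ≤-refl , axˢ
subst-typingˢ-var (suc j) zero    u a with Args-empty (lookup-∅ (j ↑ʳ zero)) a
... | refl , refl = _ , _ , 1 , keep (Agree-∅ j) , ∼L-refl , ≤-refl , axˢ
subst-typingˢ-var (suc j) (suc i) u a with subst-typingˢ-var j i u a
... | Γ′ , L′ , s′ , agree , e , s′≤ , D = [] ∷ Γ′ , L′ , s′ , keep agree , e , s′≤ , weakenˢ zero D

mutual
  subst-typingˢ : ∀ j {n} {Γ : Env (j + suc n)} {k s t L} {u : Term n} {k₂ s₂} →
    Γ ⊢ˢ[ k , s ] t ∶ L → Args u (lookup Γ (j ↑ʳ zero)) k₂ s₂ →
    ∃[ Γ′ ] ∃[ L′ ] ∃[ s′ ]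
      (Agree j Γ Γ′ × L ∼L L′ × s′ ≤ s + s₂ × Γ′ ⊢ˢ[ k + k₂ , s′ ] subst (substAt j u) t ∶ L′)
  subst-typingˢ j {u = u} (axˢ {x = x}) a = subst-typingˢ-var j x u a
  subst-typingˢ j (lamˢ D) a with subst-typingˢ (suc j) D a
  ... | _ ∷ Γ′ , L′ , s′ , keep agree , e , s′≤ , D′ =
    Γ′ , _ , suc s′ , agree , ∼M-refl ⇒∼ e , s≤s s′≤ , lamˢ D′
  subst-typingˢ j {u = u} (appˢ {Γ = Γ} {Δ} {k₁} {k₂} {s₁} {s₂} {c = c} {d} D Du e) a
    with Args-++⁻ (lookup Γ (j ↑ʳ zero)) (≡.subst (λ M → Args u M _ _) (lookup-⊕ (j ↑ʳ zero) Γ Δ) a)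
  ... | ka , sa , kb , sb , a₁ , a₂ , refl , refl with subst-typingˢ j D a₁ | subst-typingˢᴹ j Du a₂
  ... | Γ₁ , _ , _ , agree₁ , eM ⇒∼ eL , ≤₁ , D₁ | Γ₂ , _ , _ , agree₂ , eM₂ , ≤₂ , Du′ =
    Γ₁ ⊕ Γ₂ , _ , _ , Agree-⊕ agree₁ agree₂ , eL , s≤s (+-mono-≤-interchange s₁ sa s₂ sb ≤₁ ≤₂) ,
    castˢ (cost-+ c d k₁ ka k₂ kb)
      (appˢ D₁ Du′ (∼M-trans (∼M-sym eM) (∼M-trans e eM₂)))

  subst-typingˢᴹ : ∀ j {n} {Γ : Env (j + suc n)} {k s t M} {u : Term n} {k₂ s₂} →
    Γ ⊢ˢᴹ[ k , s ] t ∶ M → Args u (lookup Γ (j ↑ʳ zero)) k₂ s₂ →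
    ∃[ Γ′ ] ∃[ M′ ] ∃[ s′ ]
      (Agree j Γ Γ′ × M ∼M M′ × s′ ≤ s + s₂ × Γ′ ⊢ˢᴹ[ k + k₂ , s′ ] subst (substAt j u) t ∶ M′)
  subst-typingˢᴹ j manyˢ[] a with Args-empty (lookup-∅ (j ↑ʳ zero)) a
  ... | refl , refl = ∅ , [] , 0 , Agree-∅ j , ∼M-refl , z≤n , manyˢ[]
  subst-typingˢᴹ j {u = u} (manyˢ∷ {Γ = Γ} {Δ} {k = k} {j = k′} {s} {s′} {t} D Dm) a
    with Args-++⁻ (lookup Γ (j ↑ʳ zero)) (≡.subst (λ M → Args u M _ _) (lookup-⊕ (j ↑ʳ zero) Γ Δ) a)
  ... | ka , sa , kb , sb , a₁ , a₂ , refl , refl with subst-typingˢ j D a₁ | subst-typingˢᴹ j Dm a₂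
  ... | Γ₁ , L′ , s₁ , agree₁ , e , ≤₁ , D₁ | Γ₂ , M′ , s₂ , agree₂ , eM , ≤₂ , Dm′ =
    Γ₁ ⊕ Γ₂ , L′ ∷ M′ , s₁ + s₂ , Agree-⊕ agree₁ agree₂ , e ∷∼ eM , +-mono-≤-interchange s sa s′ sb ≤₁ ≤₂ ,
    castˢᴹ (interchange k ka k′ kb) (manyˢ∷ D₁ Dm′)

spine-reductionˢ : ∀ {n} {t t′ : Term n} {b Γ k s L} → t ⟶s[ b ] t′ → Γ ⊢ˢ[ k , s ] t ∶ L →
  ∃[ Γ′ ] ∃[ k′ ] ∃[ s′ ] ∃[ L′ ] (Γ′ ⊢ˢ[ k′ , s′ ] t′ ∶ L′ × k ≡ count b k′ × s′ < s × L ∼L L′)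
spine-reductionˢ β (appˢ {k₁ = k₁} {k₂} {s₂ = s₂} (lamˢ {s = s₁} D) Du e)
  with subst-typingˢ zero D (Equivalence.from (Args-∼ e) (Args-fromᴹ Du))
... | Γ′ , L′ , s′ , _ , eL , s′≤ , D′ =
  Γ′ , k₁ + k₂ , s′ , L′ , D′ , refl , s≤s (≤-trans s′≤ (n≤1+n (s₁ + s₂))) , eL
spine-reductionˢ {b = b} (appS st) (appˢ {Δ = Δ} {k₂ = k₂} {s₂ = s₂} {c = c} {d} D Du e)
  with spine-reductionˢ st D
... | Γ′ , k₁′ , _ , _ , D′ , refl , s′<s , eM ⇒∼ eL =
  Γ′ ⊕ Δ , cost c d k₁′ k₂ , _ , _ , appˢ D′ Du (∼M-trans (∼M-sym eM) e) ,
  cost-countˡ c d b k₁′ k₂ , s≤s (+-monoˡ-< s₂ s′<s) , eL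

subject-reductionˢ : ∀ {n} {t t′ : Term n} {b Γ k s L} → t ⟶h[ b ] t′ → Γ ⊢ˢ[ k , s ] t ∶ L →
  ∃[ Γ′ ] ∃[ k′ ] ∃[ s′ ] ∃[ L′ ] (Γ′ ⊢ˢ[ k′ , s′ ] t′ ∶ L′ × k ≡ count b k′ × s′ < s)
subject-reductionˢ (spine st) D with spine-reductionˢ st D
... | Γ′ , k′ , s′ , L′ , D′ , k≡ , s′<s , _ = Γ′ , k′ , s′ , L′ , D′ , k≡ , s′<s
subject-reductionˢ (lamH h) (lamˢ D) with subject-reductionˢ h D
... | _ ∷ Γ′ , k′ , s′ , _ , D′ , k≡ , s′<s = Γ′ , k′ , suc s′ , _ , lamˢ D′ , k≡ , s≤s s′<s

head-step? : ∀ {n} (t : Term n) → (∃[ b ] ∃[ t′ ] t ⟶h[ b ] t′) ⊎ NoHeadRedex t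
head-step? (var x) = inj₂ λ { _ _ (spine ()) }
head-step? (lam c t) with head-step? t
... | inj₁ (b , t′ , h) = inj₁ (b , lam c t′ , lamH h)
... | inj₂ nf           = inj₂ λ { _ _ (spine ()) ; b t′ (lamH h) → nf b _ h }
head-step? (app (var x) d u)   = inj₂ λ { _ _ (spine (appS ())) }
head-step? (app (lam c t) d u) = inj₁ (_ , _ , spine β)
head-step? (app (app t e v) d u) with head-step? (app t e v)
... | inj₁ (b , t′ , spine st) = inj₁ (b , app t′ d u , spine (appS st))
... | inj₂ nf                  = inj₂ λ { b _ (spine (appS st)) → nf b _ (spine st) }

soundnessˢ : ∀ {n} {Γ : Env n} {k s t L} → Γ ⊢ˢ[ k , s ] t ∶ L → ∃[ k′ ] (k′ ≤ k × t ⇓ k′)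
soundnessˢ {s = s} = <-rec Sound terminates s
  where
  Sound : ℕ → Set
  Sound s = ∀ {n} {Γ : Env n} {k t L} → Γ ⊢ˢ[ k , s ] t ∶ L → ∃[ k′ ] (k′ ≤ k × t ⇓ k′)

  terminates : ∀ s → (∀ {s′} → s′ < s → Sound s′) → Sound s
  terminates s rec {t = t} D with head-step? t
  ... | inj₂ nf = 0 , z≤n , stop nf
  ... | inj₁ (b , t′ , h) with subject-reductionˢ h D
  ... | _ , _ , _ , _ , D′ , refl , s′<s with rec s′<s D′
  ... | k′ , k′≤ , t′⇓ = count b k′ , count-mono-≤ b k′≤ , step h t′⇓

many-++ : ∀ {n} {Δ₁ Δ₂ : Env n} {a b u M₁ M₂} →
          Δ₁ ⊢M[ a ] u ∶ M₁ → Δ₂ ⊢M[ b ] u ∶ M₂ → ∃[ Δ ] (Δ ⊢M[ a + b ] u ∶ (M₁ ++ M₂))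
many-++ many[] D₂ = _ , D₂
many-++ {b = b} (many∷ {k = k} {j = j} D Dm) D₂ with many-++ Dm D₂
... | Δ , Dm′ = _ , castᴹ (sym (+-assoc k j b)) (many∷ D Dm′)

subst-typing⁻-var : ∀ j {n} (i : Fin (j + suc n)) (u : Term n) {Γ k L} → Γ ⊢[ k ] substAt j u i ∶ L →
  Agree j Γ (i ∶ₑ (L ∷ [])) × ∃[ Δ ] (Δ ⊢M[ k ] u ∶ lookup (i ∶ₑ (L ∷ [])) (j ↑ʳ zero))
subst-typing⁻-var zero    zero    u {k = k} D = start , _ , castᴹ (+-identityʳ k) (many∷ D many[])
subst-typing⁻-var zero    (suc i) u ax = start , ∅ , many[]
subst-typing⁻-var (suc j) zero    u ax =
  keep (Agree-∅ j) , ∅ , ≡.subst (∅ ⊢M[ 0 ] u ∶_) (sym (lookup-∅ (j ↑ʳ zero))) many[]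
subst-typing⁻-var (suc j) (suc i) u D with weaken⁻ zero (substAt j u i) D
... | _ , refl , D′ with subst-typing⁻-var j i u D′
... | agree , Du = keep agree , Du

mutual
  subst-typing⁻ : ∀ j {n} (t : Term (j + suc n)) (u : Term n) {Γ k L} →
    Γ ⊢[ k ] subst (substAt j u) t ∶ L →
    ∃[ Γ′ ] ∃[ k₁ ] ∃[ k₂ ] ∃[ Δ ]
      (Agree j Γ Γ′ × Γ′ ⊢[ k₁ ] t ∶ L × Δ ⊢M[ k₂ ] u ∶ lookup Γ′ (j ↑ʳ zero) × k ≡ k₁ + k₂)
  subst-typing⁻ j (var i) u {k = k} D with subst-typing⁻-var j i u D
  ... | agree , Δ , Du = _ , 0 , k , Δ , agree , ax , Du , refl
  subst-typing⁻ j (lam c t) u (lamT D) with subst-typing⁻ (suc j) t u D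
  ... | _ ∷ Γ′ , k₁ , k₂ , Δ , keep agree , D′ , Du , k≡ = Γ′ , k₁ , k₂ , Δ , agree , lamT D′ , Du , k≡
  subst-typing⁻ j (app t d t′) u (appT {c = c} D D′ e)
    with subst-typing⁻ j t u D | subst-typing⁻ᴹ j t′ u D′
  ... | Γ₁ , k₁ , k₂ , _ , agree₁ , D₁ , Du₁ , refl | Γ₂ , k₁′ , k₂′ , _ , agree₂ , D₂ , Du₂ , refl
    with many-++ Du₁ Du₂
  ... | Δ , Du = Γ₁ ⊕ Γ₂ , cost c d k₁ k₁′ , k₂ + k₂′ , Δ , Agree-⊕ agree₁ agree₂ , appT D₁ D₂ e ,
                 ≡.subst (Δ ⊢M[ k₂ + k₂′ ] u ∶_) (sym (lookup-⊕ (j ↑ʳ zero) Γ₁ Γ₂)) Du , cost-+ c d k₁ k₂ k₁′ k₂′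

  subst-typing⁻ᴹ : ∀ j {n} (t : Term (j + suc n)) (u : Term n) {Γ k M} →
    Γ ⊢M[ k ] subst (substAt j u) t ∶ M →
    ∃[ Γ′ ] ∃[ k₁ ] ∃[ k₂ ] ∃[ Δ ]
      (Agree j Γ Γ′ × Γ′ ⊢M[ k₁ ] t ∶ M × Δ ⊢M[ k₂ ] u ∶ lookup Γ′ (j ↑ʳ zero) × k ≡ k₁ + k₂)
  subst-typing⁻ᴹ j t u many[] =
    ∅ , 0 , 0 , ∅ , Agree-∅ j , many[] , ≡.subst (∅ ⊢M[ 0 ] u ∶_) (sym (lookup-∅ (j ↑ʳ zero))) many[] , refl
  subst-typing⁻ᴹ j t u (many∷ D Dm) with subst-typing⁻ j t u D | subst-typing⁻ᴹ j t u Dm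
  ... | Γ₁ , k₁ , k₂ , _ , agree₁ , D₁ , Du₁ , refl | Γ₂ , k₁′ , k₂′ , _ , agree₂ , D₂ , Du₂ , refl
    with many-++ Du₁ Du₂
  ... | Δ , Du = Γ₁ ⊕ Γ₂ , k₁ + k₁′ , k₂ + k₂′ , Δ , Agree-⊕ agree₁ agree₂ , many∷ D₁ D₂ ,
                 ≡.subst (Δ ⊢M[ k₂ + k₂′ ] u ∶_) (sym (lookup-⊕ (j ↑ʳ zero) Γ₁ Γ₂)) Du , interchange k₁ k₂ k₁′ k₂′

spine-expansion : ∀ {n} {t t′ : Term n} {b Γ′ k L} → t ⟶s[ b ] t′ → Γ′ ⊢[ k ] t′ ∶ L →
                  ∃[ Γ ] (Γ ⊢[ count b k ] t ∶ L)
spine-expansion (β {t = t} {u}) D with subst-typing⁻ zero t u D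
... | M ∷ Γ , _ , _ , _ , start , D′ , Du , refl = _ , appT (lamT D′) Du (≈M-refl M)
spine-expansion {b = b} (appS st) (appT {k₁ = k₁} {k₂} {c = c} {d} D Du e) with spine-expansion st D
... | _ , D′ = _ , cast (cost-countˡ c d b k₁ k₂) (appT D′ Du e)

subject-expansion : ∀ {n} {t t′ : Term n} {b Γ′ k L} → t ⟶h[ b ] t′ → Γ′ ⊢[ k ] t′ ∶ L →
                    ∃[ Γ ] ∃[ L′ ] (Γ ⊢[ count b k ] t ∶ L′)
subject-expansion (spine st) D with spine-expansion st D
... | Γ , D′ = Γ , _ , D′
subject-expansion (lamH h) (lamT D) with subject-expansion h D
... | _ ∷ Γ , _ , D′ = Γ , _ , lamT D′

data Neutral {n} : Term n → Set where
  var : ∀ {x} → Neutral (var x)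
  app : ∀ {t d u} → Neutral t → Neutral (app t d u)

neutral-typing : ∀ {n} {t : Term n} → Neutral t → ∀ L → ∃[ Γ ] (Γ ⊢[ 0 ] t ∶ L)
neutral-typing var L = _ , ax
neutral-typing (app {d = d} ne) L with neutral-typing ne ([] ⇒[ d ] L)
... | _ , D = _ , cast (cost-same d) (appT D many[] (≈M-refl []))

normal-app-neutral : ∀ {n} (t : Term n) {d u} → NoHeadRedex (app t d u) → Neutral (app t d u)
normal-app-neutral (var x)     nf = app var
normal-app-neutral (lam c t)   nf = ⊥-elim (nf _ _ (spine β))
normal-app-neutral (app t e v) nf =
  app (normal-app-neutral t λ { b _ (spine st) → nf b _ (spine (appS st)) })

normal-typing : ∀ {n} (t : Term n) → NoHeadRedex t → ∃[ Γ ] ∃[ L ] (Γ ⊢[ 0 ] t ∶ L)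
normal-typing (var x)     nf = _ , _ , ax {L = atom 0}
normal-typing (lam c t)   nf with normal-typing t (λ b t′ h → nf b (lam c t′) (lamH h))
... | _ ∷ Γ , _ , D = Γ , _ , lamT D
normal-typing (app t d u) nf = _ , _ , proj₂ (neutral-typing (normal-app-neutral t nf) (atom 0))

completeness : ∀ {n} {t : Term n} {k} → t ⇓ k → ∃[ Γ ] ∃[ L ] (Γ ⊢[ k ] t ∶ L)
completeness (stop nf)   = normal-typing _ nf
completeness (step h t′⇓) with completeness t′⇓
... | _ , _ , D = subject-expansion h D

theorem2 : ∀ {n : ℕ} (t : Term n) →
    ((Γ : Env n) (k : ℕ) (L : LType) → Γ ⊢[ k ] t ∶ L → ∃[ k' ] (k' ≤ k × t ⇓ k'))
    × ((k : ℕ) → t ⇓ k → ∃[ Γ ] ∃[ L ] (Γ ⊢[ k ] t ∶ L))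
theorem2 t = (λ Γ k L D → soundnessˢ (proj₂ (sized D))) , (λ k → completeness)
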